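{- Let $G$ be a star $5$-critical subcubic multigraph and let $H$ be the multigraph obtained from $G$ by deleting all vertices of degree $1$. Then $H$ has no $3$-cycle such that two of its vertices are bad.
   Context: All multigraphs are finite and loopless; subcubic means every vertex has degree at most $3$. A star $k$-edge-coloring of a multigraph is a proper edge-coloring with colors $\{1,\dots,k\}$ such that no path or cycle of length four (four edges) is bi-colored; $\chi'_s(G)$ is the least such $k$. A multigraph $G$ is star $5$-critical if $\chi'_s(G)>5$ and $\chi'_s(G-v)\leq 5$ for every vertex $v$. Degrees count edges with multiplicity. A vertex of degree $2$ in $H$ is bad if it has a neighbor in $H$ that also has degree $2$ in $H$. -}

module Defs where

open import Data.Nat using (ℕ; _≤_)
open import Data.Nat.Properties using (_≟_)
open import Data.Fin using (Fin)
import Data.Fin.Properties as FinP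
open import Data.Product using (Σ; ∃; ∃-syntax; _×_; _,_; proj₁; proj₂)
open import Data.Sum using (_⊎_)
open import Data.Unit using (⊤)
open import Data.List using (List; length; filter)
open import Data.List using (allFin)
open import Relation.Nullary using (¬_; Dec)
open import Relation.Nullary.Decidable using (_⊎-dec_; _×-dec_; ¬?)
open import Relation.Binary.PropositionalEquality using (_≡_; _≢_)

-- A finite loopless multigraph: vertices Fin n, edges Fin m (parallel
-- edges are distinct edge indices with the same endpoints).
record Multigraph : Set where
  field
    n : ℕ
    m : ℕ
    ends : Fin m → Fin n × Fin n
    loopless : ∀ e → proj₁ (ends e) ≢ proj₂ (ends e)

module _ (G : Multigraph) where
  open Multigraph G

  Vertex : Set
  Vertex = Fin n

  Edge : Set
  Edge = Fin m

  Inc : Vertex → Edge → Set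
  Inc v e = proj₁ (ends e) ≡ v ⊎ proj₂ (ends e) ≡ v

  inc? : (v : Vertex) → (e : Edge) → Dec (Inc v e)
  inc? v e = (proj₁ (ends e) FinP.≟ v) ⊎-dec (proj₂ (ends e) FinP.≟ v)

  Joins : Edge → Vertex → Vertex → Set
  Joins e u v = ends e ≡ (u , v) ⊎ ends e ≡ (v , u)

  deg : Vertex → ℕ
  deg v = length (filter (inc? v) (allFin m))

  Subcubic : Set
  Subcubic = ∀ v → deg v ≤ 3

  -- the four colors use at most two colors (with properness: exactly two)
  Bicolored : ∀ {k} → Fin k → Fin k → Fin k → Fin k → Set
  Bicolored {k} c₁ c₂ c₃ c₄ =
    Σ (Fin k) λ a → Σ (Fin k) λ b →
      (c₁ ≡ a ⊎ c₁ ≡ b) × (c₂ ≡ a ⊎ c₂ ≡ b) ×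
      (c₃ ≡ a ⊎ c₃ ≡ b) × (c₄ ≡ a ⊎ c₄ ≡ b)

  record StarColoring (k : ℕ) (S : Edge → Set) : Set where
    field
      color : Edge → Fin k
      proper : ∀ e f → e ≢ f → S e → S f →
               (∃[ v ] (Inc v e × Inc v f)) → color e ≢ color f
      -- walk v₀ e₁ v₁ e₂ v₂ e₃ v₃ e₄ v₄ which is a path (all vᵢ distinct)
      -- or a cycle (v₀..v₃ distinct, v₄ = v₀) of length four
      noBicolored4 : ∀ (v₀ v₁ v₂ v₃ v₄ : Vertex) (e₁ e₂ e₃ e₄ : Edge) →
        S e₁ → S e₂ → S e₃ → S e₄ →
        Joins e₁ v₀ v₁ → Joins e₂ v₁ v₂ → Joins e₃ v₂ v₃ → Joins e₄ v₃ v₄ →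
        v₀ ≢ v₁ → v₀ ≢ v₂ → v₀ ≢ v₃ → v₁ ≢ v₂ → v₁ ≢ v₃ → v₂ ≢ v₃ →
        v₄ ≢ v₁ → v₄ ≢ v₂ → v₄ ≢ v₃ →
        ¬ Bicolored (color e₁) (color e₂) (color e₃) (color e₄)

  AllEdges : Edge → Set
  AllEdges _ = ⊤

  EdgesOfDel : Vertex → Edge → Set
  EdgesOfDel v e = ¬ Inc v e

  StarColorable : ℕ → Set
  StarColorable k = StarColoring k AllEdges

  StarColorableDel : Vertex → ℕ → Set
  StarColorableDel v k = StarColoring k (EdgesOfDel v)

  Star5Critical : Set
  Star5Critical = (¬ StarColorable 5) × (∀ v → StarColorableDel v 5)

  InH : Vertex → Set
  InH v = deg v ≢ 1

  inH? : (v : Vertex) → Dec (InH v)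
  inH? v = ¬? (deg v ≟ 1)

  EdgeInH : Edge → Set
  EdgeInH e = InH (proj₁ (ends e)) × InH (proj₂ (ends e))

  edgeInH? : (e : Edge) → Dec (EdgeInH e)
  edgeInH? e = inH? (proj₁ (ends e)) ×-dec inH? (proj₂ (ends e))

  degH : Vertex → ℕ
  degH v = length (filter (λ e → inc? v e ×-dec edgeInH? e) (allFin m))

  AdjH : Vertex → Vertex → Set
  AdjH u w = InH u × InH w × (∃[ e ] Joins e u w)

  BadH : Vertex → Set
  BadH v = InH v × degH v ≡ 2 × (∃[ w ] (AdjH v w × degH w ≡ 2))

  TriangleTwoBad : Set
  TriangleTwoBad = ∃[ a ] ∃[ b ] ∃[ c ]
    (a ≢ b × b ≢ c × a ≢ c ×
     AdjH a b × AdjH b c × AdjH c a ×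
     BadH a × BadH b)

-- Let abc be the triangle, with a and b of degree 2 in H. Every edge at a or b other
-- than ab, bc, ca then ends at a vertex of degree 1, at most one such pendant edge hangs
-- at a and at most one at b, and c has at most one edge g leaving the triangle, ending
-- at x say. Take a star 5-edge-colouring of G - a and keep the colours of the edges that
-- avoid a and b. Colour ac and bc with two colours missing at x, and ab and the pendant
-- edges with two further colours, all four different from the colour of g. In a
-- bicoloured path or 4-cycle through a recoloured edge, the colour two steps further
-- along is available only if the walk starts at a pendant vertex, which forces the
-- walk to avoid the recoloured edges altogether; so G would be star 5-edge-colourable.

module Submission where

open import Defs
open import Data.Empty using (⊥; ⊥-elim)
open import Data.Fin using (Fin; zero; suc)
open import Data.Fin.Properties using (pigeonhole; ¬∀⟶∃¬; any?)
  renaming (_≟_ to _≟ᶠ_; <⇒≢ to <⇒≢ᶠ)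
open import Data.List using (List; []; _∷_; length; lookup; map; filter; allFin)
open import Data.List.Properties using (length-map; length-tabulate)
open import Data.List.Membership.Propositional using (_∈_; _∉_)
open import Data.List.Membership.Propositional.Properties
  using (∈-lookup; ∈-map⁺; ∈-filter⁺; ∈-allFin)
import Data.List.Membership.DecPropositional as DecMembership
open import Data.List.Relation.Binary.Subset.Propositional using (_⊆_)
open import Data.List.Relation.Unary.All as All using (All; []; _∷_)
open import Data.List.Relation.Unary.AllPairs using ([]; _∷_)
open import Data.List.Relation.Unary.Any using (here; there; index)
open import Data.List.Relation.Unary.Any.Properties using (lookup-index)
open import Data.List.Relation.Unary.Unique.Propositional using (Unique)
open import Data.List.Relation.Unary.Unique.Propositional.Properties using (allFin⁺)
open import Data.Nat using (_≤_; _<_; s≤s; z≤n; s<s; z<s)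
open import Data.Nat.Properties using (≮⇒≥; <⇒≱; m≤n⇒m≤1+n; ≤-trans; ≤-reflexive)
  renaming (_≟_ to _≟ℕ_)
open import Data.Product using (Σ; ∃; _×_; _,_; proj₁; proj₂)
open import Data.Sum using (_⊎_; inj₁; inj₂; [_,_]′; fromInj₁)
open import Data.Unit using (⊤; tt)
open import Function using (_∘_)
open import Relation.Nullary using (¬_; yes; no; contradiction)
open import Relation.Nullary.Decidable using (decidable-stable; ¬?; _×-dec_)
open import Relation.Unary using (Pred; Decidable)
open import Relation.Binary.PropositionalEquality
  using (_≡_; _≢_; refl; sym; trans; cong; cong₂; subst; ≢-sym)

lookup-injective : ∀ {A : Set} {xs : List A} → Unique xs →
                   ∀ {i j} → lookup xs i ≡ lookup xs j → i ≡ j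
lookup-injective (_   ∷ _) {zero}  {zero}  _  = refl
lookup-injective (x∉ ∷ _) {zero}  {suc j} eq = contradiction eq (All.lookup x∉ (∈-lookup j))
lookup-injective (x∉ ∷ _) {suc i} {zero}  eq = contradiction (sym eq) (All.lookup x∉ (∈-lookup i))
lookup-injective (_   ∷ u) {suc i} {suc j} eq = cong suc (lookup-injective u eq)

Unique-⊆⇒length≤ : ∀ {A : Set} {xs ys : List A} → Unique xs → xs ⊆ ys → length xs ≤ length ys
Unique-⊆⇒length≤ {xs = xs} {ys} u xs⊆ys = ≮⇒≥ λ ys<xs →
  let (i , j , i<j , same) = pigeonhole ys<xs slot
  in <⇒≢ᶠ i<j (lookup-injective u (trans (lookup-index (in-ys i))
                 (trans (cong (lookup ys) same) (sym (lookup-index (in-ys j))))))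
  where
    in-ys : ∀ i → lookup xs i ∈ ys
    in-ys i = xs⊆ys (∈-lookup i)
    slot : Fin (length xs) → Fin (length ys)
    slot i = index (in-ys i)

length≤count : ∀ {m p} {P : Pred (Fin m) p} (P? : Decidable P) {xs : List (Fin m)} →
               Unique xs → All P xs → length xs ≤ length (filter P? (allFin m))
length≤count P? u all = Unique-⊆⇒length≤ u λ {x} x∈ → ∈-filter⁺ P? (∈-allFin x) (All.lookup all x∈)

length<⇒∃∉ : ∀ {n} (xs : List (Fin n)) → length xs < n → ∃ (_∉ xs)
length<⇒∃∉ {n} xs short = ¬∀⟶∃¬ n (_∈ xs) (_∈? xs) λ all∈ →
  <⇒≱ short (subst (_≤ length xs) (length-tabulate (λ i → i))
    (Unique-⊆⇒length≤ (allFin⁺ n) (λ {i} _ → all∈ i)))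
  where open DecMembership (_≟ᶠ_ {n}) using (_∈?_)

∉⇒≢ : ∀ {A : Set} {x y : A} {xs} → x ∉ xs → y ∈ xs → x ≢ y
∉⇒≢ x∉xs y∈xs refl = x∉xs y∈xs

module _ (G : Multigraph) where
  open Multigraph G using (ends; loopless)

  joins-inc₁ : ∀ {e u v} → Joins G e u v → Inc G u e
  joins-inc₁ (inj₁ eq) = inj₁ (cong proj₁ eq)
  joins-inc₁ (inj₂ eq) = inj₂ (cong proj₂ eq)

  joins-inc₂ : ∀ {e u v} → Joins G e u v → Inc G v e
  joins-inc₂ (inj₁ eq) = inj₂ (cong proj₂ eq)
  joins-inc₂ (inj₂ eq) = inj₁ (cong proj₁ eq)

  joins-sym : ∀ {e u v} → Joins G e u v → Joins G e v u
  joins-sym (inj₁ eq) = inj₂ eq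
  joins-sym (inj₂ eq) = inj₁ eq

  joins-≢ : ∀ {e u v} → Joins G e u v → u ≢ v
  joins-≢ {e} (inj₁ eq) u≡v = loopless e (trans (cong proj₁ eq) (trans u≡v (sym (cong proj₂ eq))))
  joins-≢ {e} (inj₂ eq) u≡v = loopless e (trans (cong proj₁ eq) (trans (sym u≡v) (sym (cong proj₂ eq))))

  joins-ends : ∀ {e u v w} → Joins G e u v → Inc G w e → w ≡ u ⊎ w ≡ v
  joins-ends (inj₁ eq) (inj₁ i) = inj₁ (trans (sym i) (cong proj₁ eq))
  joins-ends (inj₁ eq) (inj₂ i) = inj₂ (trans (sym i) (cong proj₂ eq))
  joins-ends (inj₂ eq) (inj₁ i) = inj₂ (trans (sym i) (cong proj₁ eq))
  joins-ends (inj₂ eq) (inj₂ i) = inj₁ (trans (sym i) (cong proj₂ eq))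

  joins-¬inc : ∀ {e u v w} → Joins G e u v → w ≢ u → w ≢ v → ¬ Inc G w e
  joins-¬inc j w≢u w≢v = [ w≢u , w≢v ]′ ∘ joins-ends j

  joins-unique-end : ∀ {e u v w} → Joins G e u v → Joins G e u w → v ≡ w
  joins-unique-end j j′ with joins-ends j (joins-inc₂ j′)
  ... | inj₁ w≡u = contradiction (sym w≡u) (joins-≢ j′)
  ... | inj₂ w≡v = sym w≡v

  joins-orientation : ∀ {e x y s t} → Joins G e x y → Joins G e s t →
                      (s ≡ x × t ≡ y) ⊎ (s ≡ y × t ≡ x)
  joins-orientation j j′ with joins-ends j (joins-inc₁ j′)
  ... | inj₁ refl = inj₁ (refl , sym (joins-unique-end j j′))
  ... | inj₂ refl = inj₂ (refl , sym (joins-unique-end (joins-sym j) j′))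

  inc⇒joins : ∀ {e u} → Inc G u e → ∃ (Joins G e u)
  inc⇒joins {e} (inj₁ eq) = proj₂ (ends e) , inj₁ (cong₂ _,_ eq refl)
  inc⇒joins {e} (inj₂ eq) = proj₁ (ends e) , inj₂ (cong₂ _,_ refl eq)

  inc-inc⇒joins : ∀ {e u v} → Inc G u e → Inc G v e → u ≢ v → Joins G e u v
  inc-inc⇒joins (inj₁ eq) (inj₁ eq′) u≢v = contradiction (trans (sym eq) eq′) u≢v
  inc-inc⇒joins (inj₁ eq) (inj₂ eq′) _   = inj₁ (cong₂ _,_ eq eq′)
  inc-inc⇒joins (inj₂ eq) (inj₁ eq′) _   = inj₂ (cong₂ _,_ eq′ eq)
  inc-inc⇒joins (inj₂ eq) (inj₂ eq′) u≢v = contradiction (trans (sym eq) eq′) u≢v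

  joins⇒EdgeInH : ∀ {e u v} → Joins G e u v → InH G u → InH G v → EdgeInH G e
  joins⇒EdgeInH (inj₁ eq) u∈H v∈H =
    subst (λ uv → InH G (proj₁ uv) × InH G (proj₂ uv)) (sym eq) (u∈H , v∈H)
  joins⇒EdgeInH (inj₂ eq) u∈H v∈H =
    subst (λ uv → InH G (proj₁ uv) × InH G (proj₂ uv)) (sym eq) (v∈H , u∈H)

  inc-¬inc⇒≢ : ∀ {e f w} → Inc G w e → ¬ Inc G w f → e ≢ f
  inc-¬inc⇒≢ i ¬i refl = ¬i i

  consecutive-≢ : ∀ {e f x y z} → Joins G e x y → Joins G f y z → x ≢ z → e ≢ f
  consecutive-≢ j j′ x≢z refl = x≢z (joins-unique-end (joins-sym j) j′)

  deg≤1⇒edge-unique : ∀ {v e f} → deg G v ≤ 1 → Inc G v e → Inc G v f → e ≡ f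
  deg≤1⇒edge-unique {v} {e} {f} deg≤1 ie if = decidable-stable (e ≟ᶠ f) λ e≢f →
    <⇒≱ (length≤count (inc? G v) ((e≢f ∷ []) ∷ [] ∷ []) (ie ∷ if ∷ [])) deg≤1

  deg≤3⇒third-edge-unique : ∀ {v e₁ e₂ f g} → deg G v ≤ 3 → e₁ ≢ e₂ →
    Inc G v e₁ → Inc G v e₂ → Inc G v f → Inc G v g →
    f ≢ e₁ → f ≢ e₂ → g ≢ e₁ → g ≢ e₂ → f ≡ g
  deg≤3⇒third-edge-unique {v} {f = f} {g} deg≤3 e₁≢e₂ i₁ i₂ if ig f≢e₁ f≢e₂ g≢e₁ g≢e₂ =
    decidable-stable (f ≟ᶠ g) λ f≢g →
      <⇒≱ (length≤count (inc? G v)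
             ((f≢g ∷ f≢e₁ ∷ f≢e₂ ∷ []) ∷ (g≢e₁ ∷ g≢e₂ ∷ []) ∷ (e₁≢e₂ ∷ []) ∷ [] ∷ [])
             (if ∷ ig ∷ i₁ ∷ i₂ ∷ []))
          deg≤3

  degH≤2⇒other-edges-∉H : ∀ {v e₁ e₂ f} → degH G v ≤ 2 → e₁ ≢ e₂ →
    Inc G v e₁ × EdgeInH G e₁ → Inc G v e₂ × EdgeInH G e₂ →
    Inc G v f → f ≢ e₁ → f ≢ e₂ → ¬ EdgeInH G f
  degH≤2⇒other-edges-∉H {v} degH≤2 e₁≢e₂ h₁ h₂ if f≢e₁ f≢e₂ f∈H =
    <⇒≱ (length≤count (λ e → inc? G v e ×-dec edgeInH? G e)
           ((f≢e₁ ∷ f≢e₂ ∷ []) ∷ (e₁≢e₂ ∷ []) ∷ [] ∷ []) ((if , f∈H) ∷ h₁ ∷ h₂ ∷ []))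
        degH≤2

  bicolored⇒alternating : ∀ {k} {c₁ c₂ c₃ c₄ : Fin k} → c₁ ≢ c₂ → c₂ ≢ c₃ → c₃ ≢ c₄ →
                          Bicolored G c₁ c₂ c₃ c₄ → c₁ ≡ c₃ × c₂ ≡ c₄
  bicolored⇒alternating c₁≢c₂ _ _ (_ , _ , inj₁ refl , inj₁ refl , _ , _) = contradiction refl c₁≢c₂
  bicolored⇒alternating c₁≢c₂ _ _ (_ , _ , inj₂ refl , inj₂ refl , _ , _) = contradiction refl c₁≢c₂
  bicolored⇒alternating _ c₂≢c₃ _ (_ , _ , _ , inj₁ refl , inj₁ refl , _) = contradiction refl c₂≢c₃
  bicolored⇒alternating _ c₂≢c₃ _ (_ , _ , _ , inj₂ refl , inj₂ refl , _) = contradiction refl c₂≢c₃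
  bicolored⇒alternating _ _ c₃≢c₄ (_ , _ , _ , _ , inj₁ refl , inj₁ refl) = contradiction refl c₃≢c₄
  bicolored⇒alternating _ _ c₃≢c₄ (_ , _ , _ , _ , inj₂ refl , inj₂ refl) = contradiction refl c₃≢c₄
  bicolored⇒alternating _ _ _ (_ , _ , inj₁ refl , inj₂ refl , inj₁ refl , inj₂ refl) = refl , refl
  bicolored⇒alternating _ _ _ (_ , _ , inj₂ refl , inj₁ refl , inj₂ refl , inj₁ refl) = refl , refl

module Corner (G : Multigraph) (subcubic : Subcubic G)
  {v x y : Vertex G} {ex ey : Edge G} (vx : Joins G ex v x) (vy : Joins G ey v y) (x≢y : x ≢ y)
  (v∈H : InH G v) (x∈H : InH G x) (y∈H : InH G y) (degH-v : degH G v ≡ 2) where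

  not-to-x⇒≢ex : ∀ {e w} → Joins G e v w → w ≢ x → e ≢ ex
  not-to-x⇒≢ex vw w≢x = ≢-sym (inc-¬inc⇒≢ G (joins-inc₂ G vx)
    (joins-¬inc G vw (≢-sym (joins-≢ G vx)) (≢-sym w≢x)))

  not-to-y⇒≢ey : ∀ {e w} → Joins G e v w → w ≢ y → e ≢ ey
  not-to-y⇒≢ey vw w≢y = ≢-sym (inc-¬inc⇒≢ G (joins-inc₂ G vy)
    (joins-¬inc G vw (≢-sym (joins-≢ G vy)) (≢-sym w≢y)))

  ex≢ey : ex ≢ ey
  ex≢ey = not-to-y⇒≢ey vx x≢y

  other-edges-∉H : ∀ {f} → Inc G v f → f ≢ ex → f ≢ ey → ¬ EdgeInH G f
  other-edges-∉H = degH≤2⇒other-edges-∉H G (≤-reflexive degH-v) ex≢ey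
    (joins-inc₁ G vx , joins⇒EdgeInH G vx v∈H x∈H) (joins-inc₁ G vy , joins⇒EdgeInH G vy v∈H y∈H)

  x-edge-unique : ∀ {e} → Joins G e v x → e ≡ ex
  x-edge-unique {e} j = decidable-stable (e ≟ᶠ ex) λ e≢ex →
    other-edges-∉H (joins-inc₁ G j) e≢ex (not-to-y⇒≢ey j x≢y)
      (joins⇒EdgeInH G j v∈H x∈H)

  y-edge-unique : ∀ {e} → Joins G e v y → e ≡ ey
  y-edge-unique {e} j = decidable-stable (e ≟ᶠ ey) λ e≢ey →
    other-edges-∉H (joins-inc₁ G j) (not-to-x⇒≢ex j (≢-sym x≢y)) e≢ey
      (joins⇒EdgeInH G j v∈H y∈H)

  module Outer {e w} (vw : Joins G e v w) (w≢x : w ≢ x) (w≢y : w ≢ y) where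

    pendant : ∀ {f} → Inc G w f → f ≡ e
    pendant w∈f = deg≤1⇒edge-unique G (≤-reflexive deg-w≡1) w∈f (joins-inc₂ G vw)
      where
        deg-w≡1 : deg G w ≡ 1
        deg-w≡1 = decidable-stable (deg G w ≟ℕ 1) λ w∈H →
          other-edges-∉H (joins-inc₁ G vw) (not-to-x⇒≢ex vw w≢x) (not-to-y⇒≢ey vw w≢y)
            (joins⇒EdgeInH G vw v∈H w∈H)

    returns : ∀ {f t} → Joins G f w t → t ≡ v
    returns wt with pendant (joins-inc₁ G wt)
    ... | refl = sym (joins-unique-end G (joins-sym G vw) wt)

    unique : ∀ {f w′} → Joins G f v w′ → w′ ≢ x → w′ ≢ y → e ≡ f
    unique vw′ w′≢x w′≢y =
      deg≤3⇒third-edge-unique G (subcubic v) ex≢ey (joins-inc₁ G vx) (joins-inc₁ G vy)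
        (joins-inc₁ G vw) (joins-inc₁ G vw′)
        (not-to-x⇒≢ex vw w≢x) (not-to-y⇒≢ey vw w≢y) (not-to-x⇒≢ex vw′ w′≢x) (not-to-y⇒≢ey vw′ w′≢y)

data Slot : Set where
  ab ac bc out : Slot

slot-index : Slot → Fin 4
slot-index ab  = zero
slot-index ac  = suc zero
slot-index bc  = suc (suc zero)
slot-index out = suc (suc (suc zero))

slot-index-injective : ∀ {σ τ} → slot-index σ ≡ slot-index τ → σ ≡ τ
slot-index-injective {ab}  {ab}  _ = refl
slot-index-injective {ac}  {ac}  _ = refl
slot-index-injective {bc}  {bc}  _ = refl
slot-index-injective {out} {out} _ = refl

record Palette (avoid : List (Fin 5)) (α : Fin 5) : Set where
  field
    colour           : Slot → Fin 5
    colour-injective : ∀ {σ τ} → colour σ ≡ colour τ → σ ≡ τ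
    ac∉avoid         : colour ac ∉ avoid
    bc∉avoid         : colour bc ∉ avoid
    colour≢α         : ∀ σ → colour σ ≢ α

palette : (avoid : List (Fin 5)) → length avoid ≤ 3 → ∀ {α} → α ∈ avoid → Palette avoid α
palette avoid short {α} α∈avoid
  with length<⇒∃∉ avoid (s≤s (m≤n⇒m≤1+n short))
... | p , p∉ with length<⇒∃∉ (p ∷ avoid) (s≤s (s≤s short))
... | q , q∉ with length<⇒∃∉ (α ∷ p ∷ q ∷ []) (s<s (s<s (s<s z<s)))
... | r , r∉ with length<⇒∃∉ (α ∷ p ∷ q ∷ r ∷ []) (s<s (s<s (s<s (s<s z<s))))
... | s , s∉ = record
  { colour           = colour
  ; colour-injective = λ eq → slot-index-injective (lookup-injective distinct eq)
  ; ac∉avoid         = p∉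
  ; bc∉avoid         = q∉ ∘ there
  ; colour≢α         = λ where
      ab  → ∉⇒≢ r∉ (here refl)
      ac  → ∉⇒≢ p∉ α∈avoid
      bc  → ∉⇒≢ q∉ (there α∈avoid)
      out → ∉⇒≢ s∉ (here refl)
  }
  where
    colours : List (Fin 5)
    colours = r ∷ p ∷ q ∷ s ∷ []

    colour : Slot → Fin 5
    colour σ = lookup colours (slot-index σ)

    distinct : Unique colours
    distinct = (∉⇒≢ r∉ (there (here refl)) ∷ ∉⇒≢ r∉ (there (there (here refl)))
                 ∷ ≢-sym (∉⇒≢ s∉ (there (there (there (here refl))))) ∷ [])
             ∷ (≢-sym (∉⇒≢ q∉ (here refl)) ∷ ≢-sym (∉⇒≢ s∉ (there (here refl))) ∷ [])
             ∷ (≢-sym (∉⇒≢ s∉ (there (there (here refl)))) ∷ [])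
             ∷ [] ∷ []

module Triangle (G : Multigraph) (subcubic : Subcubic G)
  {a b c : Vertex G} (a≢b : a ≢ b) (b≢c : b ≢ c) (a≢c : a ≢ c)
  {eab ebc eca : Edge G} (jab : Joins G eab a b) (jbc : Joins G ebc b c) (jca : Joins G eca c a)
  (a∈H : InH G a) (b∈H : InH G b) (c∈H : InH G c) (degH-a : degH G a ≡ 2) (degH-b : degH G b ≡ 2)
  where

  module A = Corner G subcubic jab (joins-sym G jca) b≢c a∈H b∈H c∈H degH-a
  module B = Corner G subcubic (joins-sym G jab) jbc a≢c b∈H a∈H c∈H degH-b

  Far : Edge G → Set
  Far e = ¬ Inc G a e × ¬ Inc G b e

  far-at-c-unique : ∀ {f g} → Far f → Inc G c f → Far g → Inc G c g → f ≡ g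
  far-at-c-unique (a∉f , b∉f) c∈f (a∉g , b∉g) c∈g =
    deg≤3⇒third-edge-unique G (subcubic c) eca≢ebc (joins-inc₁ G jca) (joins-inc₂ G jbc) c∈f c∈g
      (≢-sym (inc-¬inc⇒≢ G (joins-inc₂ G jca) a∉f)) (≢-sym (inc-¬inc⇒≢ G (joins-inc₁ G jbc) b∉f))
      (≢-sym (inc-¬inc⇒≢ G (joins-inc₂ G jca) a∉g)) (≢-sym (inc-¬inc⇒≢ G (joins-inc₁ G jbc) b∉g))
    where
      eca≢ebc : eca ≢ ebc
      eca≢ebc = inc-¬inc⇒≢ G (joins-inc₂ G jca) (joins-¬inc G jbc a≢b a≢c)

  data Local (e : Edge G) : Slot → Set where
    ab    : Joins G e a b → Local e ab
    ac    : Joins G e a c → Local e ac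
    bc    : Joins G e b c → Local e bc
    a-out : ∀ {w} → Joins G e a w → w ≢ b → w ≢ c → Local e out
    b-out : ∀ {w} → Joins G e b w → w ≢ a → w ≢ c → Local e out

  Local⇒¬Far : ∀ {e σ} → Local e σ → ¬ Far e
  Local⇒¬Far (ab j)        (a∉e , _) = a∉e (joins-inc₁ G j)
  Local⇒¬Far (ac j)        (a∉e , _) = a∉e (joins-inc₁ G j)
  Local⇒¬Far (bc j)        (_ , b∉e) = b∉e (joins-inc₁ G j)
  Local⇒¬Far (a-out j _ _) (a∉e , _) = a∉e (joins-inc₁ G j)
  Local⇒¬Far (b-out j _ _) (_ , b∉e) = b∉e (joins-inc₁ G j)

  a-out-meets-b-out : ∀ {v e f x y} → Inc G v e → Inc G v f →
    Joins G e a x → x ≢ b → x ≢ c → Joins G f b y → y ≢ a → e ≡ f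
  a-out-meets-b-out v∈e v∈f ax x≢b x≢c by y≢a with joins-ends G ax v∈e
  ... | inj₁ refl = ⊥-elim (joins-¬inc G by a≢b (≢-sym y≢a) v∈f)
  ... | inj₂ refl = sym (A.Outer.pendant ax x≢b x≢c v∈f)

  same-slot-adjacent : ∀ {v e f σ} → Inc G v e → Inc G v f → Local e σ → Local f σ → e ≡ f
  same-slot-adjacent _ _ (ab j) (ab j′) = trans (A.x-edge-unique j) (sym (A.x-edge-unique j′))
  same-slot-adjacent _ _ (ac j) (ac j′) = trans (A.y-edge-unique j) (sym (A.y-edge-unique j′))
  same-slot-adjacent _ _ (bc j) (bc j′) = trans (B.y-edge-unique j) (sym (B.y-edge-unique j′))
  same-slot-adjacent _ _ (a-out j x≢b x≢c) (a-out j′ y≢b y≢c) = A.Outer.unique j x≢b x≢c j′ y≢b y≢c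
  same-slot-adjacent _ _ (b-out j x≢a x≢c) (b-out j′ y≢a y≢c) = B.Outer.unique j x≢a x≢c j′ y≢a y≢c
  same-slot-adjacent v∈e v∈f (a-out j x≢b x≢c) (b-out j′ y≢a _) = a-out-meets-b-out v∈e v∈f j x≢b x≢c j′ y≢a
  same-slot-adjacent v∈e v∈f (b-out j x≢a _) (a-out j′ y≢b y≢c) = sym (a-out-meets-b-out v∈f v∈e j′ y≢b y≢c j x≢a)

  Kind : Edge G → Set
  Kind e = Σ Slot (Local e) ⊎ Far e

  IsFar : ∀ {e} → Kind e → Set
  IsFar (inj₁ _) = ⊥
  IsFar (inj₂ _) = ⊤

  classify : ∀ e → Kind e
  classify e with inc? G a e | inc? G b e
  ... | yes a∈e | yes b∈e = inj₁ (ab , ab (inc-inc⇒joins G a∈e b∈e a≢b))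
  ... | yes a∈e | no b∉e with inc⇒joins G a∈e
  ...   | w , j with w ≟ᶠ c
  ...     | yes refl = inj₁ (ac , ac j)
  ...     | no w≢c   = inj₁ (out , a-out j (λ { refl → b∉e (joins-inc₂ G j) }) w≢c)
  classify e | no a∉e | yes b∈e with inc⇒joins G b∈e
  ...   | w , j with w ≟ᶠ c
  ...     | yes refl = inj₁ (bc , bc j)
  ...     | no w≢c   = inj₁ (out , b-out j (λ { refl → a∉e (joins-inc₂ G j) }) w≢c)
  classify e | no a∉e | no b∉e = inj₂ (a∉e , b∉e)

  module Recolouring (φ : StarColoring G 5 (EdgesOfDel G a))
    (colour : Slot → Fin 5) (colour-injective : ∀ {σ τ} → colour σ ≡ colour τ → σ ≡ τ)
    (far-at-c : ∀ {f σ} → Far f → Inc G c f → StarColoring.color φ f ≢ colour σ)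
    (far-beyond-c : ∀ {g w f} → Far g → Joins G g c w → Far f → Inc G w f →
                    StarColoring.color φ f ≢ colour ac × StarColoring.color φ f ≢ colour bc)
    where

    open StarColoring φ using ()
      renaming (color to old; proper to old-proper; noBicolored4 to old-star)

    recolour : ∀ {e} → Kind e → Fin 5
    recolour     (inj₁ (σ , _)) = colour σ
    recolour {e} (inj₂ _)       = old e

    Coloured : Edge G → Slot → Set
    Coloured f σ = Local f σ ⊎ (Far f × old f ≡ colour σ)

    recolour≡colour : ∀ {f σ} (k : Kind f) → recolour k ≡ colour σ → Coloured f σ
    recolour≡colour (inj₁ (_ , ℓ)) eq with colour-injective eq
    ... | refl = inj₁ ℓ
    recolour≡colour (inj₂ far) eq = inj₂ (far , eq)

    ¬ab-coloured-at-c : ∀ {f} → Inc G c f → ¬ Coloured f ab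
    ¬ab-coloured-at-c c∈f (inj₁ (ab j))     = joins-¬inc G j (≢-sym a≢c) (≢-sym b≢c) c∈f
    ¬ab-coloured-at-c c∈f (inj₂ (far , eq)) = far-at-c far c∈f eq

    ¬ac-coloured-at-b : ∀ {f} → Inc G b f → ¬ Coloured f ac
    ¬ac-coloured-at-b b∈f (inj₁ (ac j))           = joins-¬inc G j (≢-sym a≢b) b≢c b∈f
    ¬ac-coloured-at-b b∈f (inj₂ ((_ , b∉f) , _)) = b∉f b∈f

    ¬bc-coloured-at-a : ∀ {f} → Inc G a f → ¬ Coloured f bc
    ¬bc-coloured-at-a a∈f (inj₁ (bc j))           = joins-¬inc G j a≢b a≢c a∈f
    ¬bc-coloured-at-a a∈f (inj₂ ((a∉f , _) , _)) = a∉f a∈f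

    ¬ac-coloured-beyond-c : ∀ {g w f} → Far g → Joins G g c w → Inc G w f → ¬ Coloured f ac
    ¬ac-coloured-beyond-c (a∉g , _) cw w∈f (inj₁ (ac j)) with joins-ends G j w∈f
    ... | inj₁ refl = a∉g (joins-inc₂ G cw)
    ... | inj₂ refl = joins-≢ G cw refl
    ¬ac-coloured-beyond-c far-g cw w∈f (inj₂ (far-f , eq)) = proj₁ (far-beyond-c far-g cw far-f w∈f) eq

    ¬bc-coloured-beyond-c : ∀ {g w f} → Far g → Joins G g c w → Inc G w f → ¬ Coloured f bc
    ¬bc-coloured-beyond-c (_ , b∉g) cw w∈f (inj₁ (bc j)) with joins-ends G j w∈f
    ... | inj₁ refl = b∉g (joins-inc₂ G cw)
    ... | inj₂ refl = joins-≢ G cw refl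
    ¬bc-coloured-beyond-c far-g cw w∈f (inj₂ (far-f , eq)) = proj₂ (far-beyond-c far-g cw far-f w∈f) eq

    ab-two-steps : ∀ {e₁ e₂ e₃ s u w t} → Joins G e₁ a b →
      Joins G e₁ s u → Joins G e₂ u w → Joins G e₃ w t → s ≢ w → u ≢ t → ¬ Coloured e₃ ab
    ab-two-steps {w = w} j j₁ j₂ j₃ s≢w u≢t with joins-orientation G j j₁ | w ≟ᶠ c
    ... | _                  | yes refl = ¬ab-coloured-at-c (joins-inc₁ G j₃)
    ... | inj₁ (refl , refl) | no w≢c   = λ _ → u≢t (sym (B.Outer.returns j₂ (≢-sym s≢w) w≢c j₃))
    ... | inj₂ (refl , refl) | no w≢c   = λ _ → u≢t (sym (A.Outer.returns j₂ (≢-sym s≢w) w≢c j₃))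

    ac-two-steps : ∀ {e₁ e₂ e₃ s u w t} → Joins G e₁ a c →
      Joins G e₁ s u → Joins G e₂ u w → Joins G e₃ w t → s ≢ w → u ≢ t → ¬ Coloured e₃ ac
    ac-two-steps {w = w} j j₁ j₂ j₃ s≢w u≢t with joins-orientation G j j₁ | w ≟ᶠ b
    ... | _                  | yes refl = ¬ac-coloured-at-b (joins-inc₁ G j₃)
    ... | inj₁ (refl , refl) | no w≢b   =
      ¬ac-coloured-beyond-c (joins-¬inc G j₂ a≢c s≢w , joins-¬inc G j₂ b≢c (≢-sym w≢b)) j₂ (joins-inc₁ G j₃)
    ... | inj₂ (refl , refl) | no w≢b   = λ _ → u≢t (sym (A.Outer.returns j₂ w≢b (≢-sym s≢w) j₃))

    bc-two-steps : ∀ {e₁ e₂ e₃ s u w t} → Joins G e₁ b c →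
      Joins G e₁ s u → Joins G e₂ u w → Joins G e₃ w t → s ≢ w → u ≢ t → ¬ Coloured e₃ bc
    bc-two-steps {w = w} j j₁ j₂ j₃ s≢w u≢t with joins-orientation G j j₁ | w ≟ᶠ a
    ... | _                  | yes refl = ¬bc-coloured-at-a (joins-inc₁ G j₃)
    ... | inj₁ (refl , refl) | no w≢a   =
      ¬bc-coloured-beyond-c (joins-¬inc G j₂ a≢c (≢-sym w≢a) , joins-¬inc G j₂ b≢c s≢w) j₂ (joins-inc₁ G j₃)
    ... | inj₂ (refl , refl) | no w≢a   = λ _ → u≢t (sym (B.Outer.returns j₂ w≢a (≢-sym s≢w) j₃))

    a-out-two-steps : ∀ {e₁ e₂ e₃ s u w t x} → Joins G e₁ a x → x ≢ b → x ≢ c →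
      Joins G e₁ s u → Joins G e₂ u w → Joins G e₃ w t → s ≢ w → Coloured e₃ out →
      (∀ {h} → Inc G s h → h ≡ e₁) × Local e₃ out
    a-out-two-steps {e₃ = e₃} {w = w} j x≢b x≢c j₁ j₂ j₃ s≢w col with joins-orientation G j j₁
    ... | inj₁ (refl , refl) = ⊥-elim (s≢w (sym (A.Outer.returns j x≢b x≢c j₂)))
    ... | inj₂ (refl , refl) = A.Outer.pendant j x≢b x≢c , local col
      where
        local : Coloured e₃ out → Local e₃ out
        local (inj₁ ℓ) = ℓ
        local (inj₂ (far , eq)) with w ≟ᶠ b | w ≟ᶠ c
        ... | yes refl | _        = ⊥-elim (proj₂ far (joins-inc₁ G j₃))
        ... | no _     | yes refl = ⊥-elim (far-at-c far (joins-inc₁ G j₃) eq)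
        ... | no w≢b   | no w≢c with A.Outer.unique j x≢b x≢c j₂ w≢b w≢c
        ...   | refl = ⊥-elim (s≢w (joins-unique-end G j j₂))

    b-out-two-steps : ∀ {e₁ e₂ e₃ s u w t x} → Joins G e₁ b x → x ≢ a → x ≢ c →
      Joins G e₁ s u → Joins G e₂ u w → Joins G e₃ w t → s ≢ w → Coloured e₃ out →
      (∀ {h} → Inc G s h → h ≡ e₁) × Local e₃ out
    b-out-two-steps {e₃ = e₃} {w = w} j x≢a x≢c j₁ j₂ j₃ s≢w col with joins-orientation G j j₁
    ... | inj₁ (refl , refl) = ⊥-elim (s≢w (sym (B.Outer.returns j x≢a x≢c j₂)))
    ... | inj₂ (refl , refl) = B.Outer.pendant j x≢a x≢c , local col
      where
        local : Coloured e₃ out → Local e₃ out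
        local (inj₁ ℓ) = ℓ
        local (inj₂ (far , eq)) with w ≟ᶠ a | w ≟ᶠ c
        ... | yes refl | _        = ⊥-elim (proj₁ far (joins-inc₁ G j₃))
        ... | no _     | yes refl = ⊥-elim (far-at-c far (joins-inc₁ G j₃) eq)
        ... | no w≢a   | no w≢c with B.Outer.unique j x≢a x≢c j₂ w≢a w≢c
        ...   | refl = ⊥-elim (s≢w (joins-unique-end G j j₂))

    two-steps-from-local : ∀ {e₁ e₂ e₃ s u w t σ} →
      Joins G e₁ s u → Joins G e₂ u w → Joins G e₃ w t → s ≢ w → u ≢ t →
      Local e₁ σ → Coloured e₃ σ → (∀ {h} → Inc G s h → h ≡ e₁) × Local e₃ σ
    two-steps-from-local j₁ j₂ j₃ s≢w u≢t (ab j) col = ⊥-elim (ab-two-steps j j₁ j₂ j₃ s≢w u≢t col)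
    two-steps-from-local j₁ j₂ j₃ s≢w u≢t (ac j) col = ⊥-elim (ac-two-steps j j₁ j₂ j₃ s≢w u≢t col)
    two-steps-from-local j₁ j₂ j₃ s≢w u≢t (bc j) col = ⊥-elim (bc-two-steps j j₁ j₂ j₃ s≢w u≢t col)
    two-steps-from-local j₁ j₂ j₃ s≢w _ (a-out j x≢b x≢c) col = a-out-two-steps j x≢b x≢c j₁ j₂ j₃ s≢w col
    two-steps-from-local j₁ j₂ j₃ s≢w _ (b-out j x≢a x≢c) col = b-out-two-steps j x≢a x≢c j₁ j₂ j₃ s≢w col

    local-far-≢ : ∀ {v e f σ} → Inc G v e → Inc G v f → Local e σ → Far f → old f ≢ colour σ
    local-far-≢ v∈e v∈f (ab j) (a∉f , b∉f) _ with joins-ends G j v∈e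
    ... | inj₁ refl = a∉f v∈f
    ... | inj₂ refl = b∉f v∈f
    local-far-≢ v∈e v∈f (ac j) far@(a∉f , _) with joins-ends G j v∈e
    ... | inj₁ refl = λ _ → a∉f v∈f
    ... | inj₂ refl = far-at-c far v∈f
    local-far-≢ v∈e v∈f (bc j) far@(_ , b∉f) with joins-ends G j v∈e
    ... | inj₁ refl = λ _ → b∉f v∈f
    ... | inj₂ refl = far-at-c far v∈f
    local-far-≢ v∈e v∈f (a-out j x≢b x≢c) (a∉f , _) _ with joins-ends G j v∈e
    ... | inj₁ refl = a∉f v∈f
    ... | inj₂ refl with A.Outer.pendant j x≢b x≢c v∈f
    ...   | refl = a∉f (joins-inc₁ G j)
    local-far-≢ v∈e v∈f (b-out j x≢a x≢c) (_ , b∉f) _ with joins-ends G j v∈e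
    ... | inj₁ refl = b∉f v∈f
    ... | inj₂ refl with B.Outer.pendant j x≢a x≢c v∈f
    ...   | refl = b∉f (joins-inc₁ G j)

    recolour-proper : ∀ {v e f} → e ≢ f → Inc G v e → Inc G v f →
                      (k : Kind e) (k′ : Kind f) → recolour k ≢ recolour k′
    recolour-proper e≢f v∈e v∈f (inj₁ (_ , ℓ)) k′ eq with recolour≡colour k′ (sym eq)
    ... | inj₁ ℓ′          = e≢f (same-slot-adjacent v∈e v∈f ℓ ℓ′)
    ... | inj₂ (far , eq′) = local-far-≢ v∈e v∈f ℓ far eq′
    recolour-proper _ v∈e v∈f (inj₂ far) (inj₁ (_ , ℓ)) = local-far-≢ v∈f v∈e ℓ far
    recolour-proper {v} {e} {f} e≢f v∈e v∈f (inj₂ (a∉e , _)) (inj₂ (a∉f , _)) =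
      old-proper e f e≢f a∉e a∉f (v , v∈e , v∈f)

    far-or-pendant : ∀ {e₁ e₂ e₃ s u w t} (k₁ : Kind e₁) (k₃ : Kind e₃) → recolour k₁ ≡ recolour k₃ →
      Joins G e₁ s u → Joins G e₂ u w → Joins G e₃ w t → s ≢ w → u ≢ t →
      IsFar k₁ ⊎ ((∀ {h} → Inc G s h → h ≡ e₁) × ¬ IsFar k₃)
    far-or-pendant (inj₂ _) _ _ _ _ _ _ _ = inj₁ tt
    far-or-pendant (inj₁ (_ , ℓ)) k₃ eq j₁ j₂ j₃ s≢w u≢t
      with two-steps-from-local j₁ j₂ j₃ s≢w u≢t ℓ (recolour≡colour k₃ (sym eq))
    ... | pendant , ℓ₃ = inj₂ (pendant , Local⇒¬IsFar k₃ ℓ₃)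
      where
        Local⇒¬IsFar : ∀ {e σ} (k : Kind e) → Local e σ → ¬ IsFar k
        Local⇒¬IsFar (inj₁ _)   _ ()
        Local⇒¬IsFar (inj₂ far) ℓ _ = Local⇒¬Far ℓ far

    recolour-star : ∀ {v₀ v₁ v₂ v₃ v₄ e₁ e₂ e₃ e₄} →
      Joins G e₁ v₀ v₁ → Joins G e₂ v₁ v₂ → Joins G e₃ v₂ v₃ → Joins G e₄ v₃ v₄ →
      v₀ ≢ v₁ → v₀ ≢ v₂ → v₀ ≢ v₃ → v₁ ≢ v₂ → v₁ ≢ v₃ → v₂ ≢ v₃ →
      v₄ ≢ v₁ → v₄ ≢ v₂ → v₄ ≢ v₃ →
      (k₁ : Kind e₁) (k₂ : Kind e₂) (k₃ : Kind e₃) (k₄ : Kind e₄) →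
      ¬ Bicolored G (recolour k₁) (recolour k₂) (recolour k₃) (recolour k₄)
    recolour-star {v₀} {v₁} {v₂} {v₃} {v₄} {e₁} {e₂} {e₃} {e₄} j₁ j₂ j₃ j₄
      v₀≢v₁ v₀≢v₂ v₀≢v₃ v₁≢v₂ v₁≢v₃ v₂≢v₃ v₄≢v₁ v₄≢v₂ v₄≢v₃ k₁ k₂ k₃ k₄ bic =
      all-far k₁ k₂ k₃ k₄ far₁ far₂ far₃ far₄ bic
      where
        e₁≢e₂ : e₁ ≢ e₂
        e₁≢e₂ = consecutive-≢ G j₁ j₂ v₀≢v₂
        e₃≢e₄ : e₃ ≢ e₄
        e₃≢e₄ = consecutive-≢ G j₃ j₄ (≢-sym v₄≢v₂)

        alternating : recolour k₁ ≡ recolour k₃ × recolour k₂ ≡ recolour k₄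
        alternating = bicolored⇒alternating G
          (recolour-proper e₁≢e₂ (joins-inc₂ G j₁) (joins-inc₁ G j₂) k₁ k₂)
          (recolour-proper (consecutive-≢ G j₂ j₃ v₁≢v₃) (joins-inc₂ G j₂) (joins-inc₁ G j₃) k₂ k₃)
          (recolour-proper e₃≢e₄ (joins-inc₂ G j₃) (joins-inc₁ G j₄) k₃ k₄)
          bic

        far₂ : IsFar k₂
        far₂ = fromInj₁ (λ (pendant , _) → ⊥-elim (e₁≢e₂ (pendant (joins-inc₂ G j₁))))
          (far-or-pendant k₂ k₄ (proj₂ alternating) j₂ j₃ j₄ v₁≢v₃ (≢-sym v₄≢v₂))

        far₃ : IsFar k₃
        far₃ = fromInj₁ (λ (pendant , _) → ⊥-elim (e₃≢e₄ (sym (pendant (joins-inc₁ G j₄)))))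
          (far-or-pendant k₃ k₁ (sym (proj₁ alternating))
            (joins-sym G j₃) (joins-sym G j₂) (joins-sym G j₁) (≢-sym v₁≢v₃) (≢-sym v₀≢v₂))

        far₁ : IsFar k₁
        far₁ = fromInj₁ (λ (_ , ¬far₃) → ⊥-elim (¬far₃ far₃))
          (far-or-pendant k₁ k₃ (proj₁ alternating) j₁ j₂ j₃ v₀≢v₂ v₁≢v₃)

        far₄ : IsFar k₄
        far₄ = fromInj₁ (λ (_ , ¬far₂) → ⊥-elim (¬far₂ far₂))
          (far-or-pendant k₄ k₂ (sym (proj₂ alternating))
            (joins-sym G j₄) (joins-sym G j₃) (joins-sym G j₂) v₄≢v₂ (≢-sym v₁≢v₃))

        all-far : (k₁ : Kind e₁) (k₂ : Kind e₂) (k₃ : Kind e₃) (k₄ : Kind e₄) →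
          IsFar k₁ → IsFar k₂ → IsFar k₃ → IsFar k₄ →
          ¬ Bicolored G (recolour k₁) (recolour k₂) (recolour k₃) (recolour k₄)
        all-far (inj₂ (a∉e₁ , _)) (inj₂ (a∉e₂ , _)) (inj₂ (a∉e₃ , _)) (inj₂ (a∉e₄ , _)) _ _ _ _ =
          old-star v₀ v₁ v₂ v₃ v₄ e₁ e₂ e₃ e₄ a∉e₁ a∉e₂ a∉e₃ a∉e₄ j₁ j₂ j₃ j₄
            v₀≢v₁ v₀≢v₂ v₀≢v₃ v₁≢v₂ v₁≢v₃ v₂≢v₃ v₄≢v₁ v₄≢v₂ v₄≢v₃

    star-colouring : StarColorable G 5
    star-colouring = record
      { color        = λ e → recolour (classify e)
      ; proper       = λ e f e≢f _ _ (v , v∈e , v∈f) →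
                         recolour-proper e≢f v∈e v∈f (classify e) (classify f)
      ; noBicolored4 = λ _ _ _ _ _ e₁ e₂ e₃ e₄ _ _ _ _ j₁ j₂ j₃ j₄ d₀₁ d₀₂ d₀₃ d₁₂ d₁₃ d₂₃ d₄₁ d₄₂ d₄₃ →
                         recolour-star j₁ j₂ j₃ j₄ d₀₁ d₀₂ d₀₃ d₁₂ d₁₃ d₂₃ d₄₁ d₄₂ d₄₃
                           (classify e₁) (classify e₂) (classify e₃) (classify e₄)
      }

  -- The palette is passed to from-palette as a variable: unfolding its construction
  -- while checking the colouring makes type checking exhaust memory.
  recolourable : StarColorableDel G a 5 → StarColorable G 5
  recolourable φ with any? (λ g → (¬? (inc? G a g) ×-dec ¬? (inc? G b g)) ×-dec inc? G c g)
  ... | no no-far-at-c = from-palette (palette (zero ∷ []) (s≤s z≤n) (here refl))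
    where
      from-palette : Palette (zero ∷ []) zero → StarColorable G 5
      from-palette P = Recolouring.star-colouring φ colour colour-injective
          (λ far c∈f → ⊥-elim (no-far-at-c (_ , far , c∈f)))
          (λ far cw _ _ → ⊥-elim (no-far-at-c (_ , far , joins-inc₁ G cw)))
        where open Palette P
  ... | yes (g , far-g , c∈g) = from-palette (palette colours-at-x at-most-3 (at-x (joins-inc₂ G cx)))
    where
      open StarColoring φ using () renaming (color to old)
      x = proj₁ (inc⇒joins G c∈g)
      cx = proj₂ (inc⇒joins G c∈g)

      colours-at-x : List (Fin 5)
      colours-at-x = map old (filter (inc? G x) (allFin _))

      at-x : ∀ {f} → Inc G x f → old f ∈ colours-at-x
      at-x {f} x∈f = ∈-map⁺ old (∈-filter⁺ (inc? G x) (∈-allFin f) x∈f)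

      at-most-3 : length colours-at-x ≤ 3
      at-most-3 = ≤-trans (≤-reflexive (length-map old (filter (inc? G x) (allFin _)))) (subcubic x)

      from-palette : Palette colours-at-x (old g) → StarColorable G 5
      from-palette P = Recolouring.star-colouring φ colour colour-injective at-c beyond-c
        where
          open Palette P
          at-c : ∀ {f σ} → Far f → Inc G c f → old f ≢ colour σ
          at-c {σ = σ} far c∈f with far-at-c-unique far c∈f far-g c∈g
          ... | refl = ≢-sym (colour≢α σ)
          beyond-c : ∀ {g′ w f} → Far g′ → Joins G g′ c w → Far f → Inc G w f →
                     old f ≢ colour ac × old f ≢ colour bc
          beyond-c far-g′ cw _ w∈f with far-at-c-unique far-g′ (joins-inc₁ G cw) far-g c∈g
          ... | refl with joins-unique-end G cw cx
          ...   | refl = (λ eq → ac∉avoid (subst (_∈ colours-at-x) eq (at-x w∈f)))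
                       , (λ eq → bc∉avoid (subst (_∈ colours-at-x) eq (at-x w∈f)))

lemma2p5 : (G : Multigraph) → Subcubic G → Star5Critical G →
    ¬ TriangleTwoBad G
lemma2p5 G subcubic (not-colourable , critical)
  (a , b , c , a≢b , b≢c , a≢c , (a∈H , b∈H , eab , jab) , (_ , c∈H , ebc , jbc) , (_ , _ , eca , jca)
  , (_ , degH-a , _) , (_ , degH-b , _)) =
  not-colourable (Triangle.recolourable G subcubic a≢b b≢c a≢c jab jbc jca a∈H b∈H c∈H degH-a degH-b (critical a))
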